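{- Let $k\ge1$, let $\tau$ be a pattern (permutation) of length $k+1$, and let $w$ be a word avoiding $\tau$ that represents a graph $G=(V,E)$ whose vertices are labeled by distinct elements of a totally ordered set. Let $x\in V$. If some vertex $a$ adjacent to $x$ has degree at least $k$, then $x$ occurs at most $k+1$ times in $w$.
   Context: All graphs are simple. A word is a finite sequence of letters from a totally ordered alphabet. Two letters $x,y$ alternate in a word $w$ if between any two occurrences of $x$ there is an occurrence of $y$ and between any two occurrences of $y$ there is an occurrence of $x$. A graph $G=(V,E)$ is represented by a word $w$ over $V$ if for all distinct $x,y\in V$, $x$ and $y$ alternate in $w$ if and only if $xy\in E$. A word $w=w_1\cdots w_n$ contains a pattern $\tau=\tau_1\cdots\tau_m$ if some subsequence $w_{i_1}\cdots w_{i_m}$ ($i_1<\dots<i_m$) is order-isomorphic to $\tau$; otherwise it avoids $\tau$. -}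

module Defs where

open import Data.Nat using (ℕ; suc; _≤_)
open import Data.Fin using (Fin; _<_; _≟_)
open import Data.List using (List; length; lookup; filter; allFin)

open import Data.Product using (Σ; _×_; ∃-syntax)
open import Relation.Binary.PropositionalEquality using (_≡_; _≢_)
open import Relation.Nullary using (Dec; ¬_)


-- A simple graph on the vertex set Fin n (vertex labels ordered by the order of Fin n).
record SimpleGraph (n : ℕ) : Set₁ where
  field
    Adj   : Fin n → Fin n → Set
    adj?  : ∀ x y → Dec (Adj x y)
    sym   : ∀ {x y} → Adj x y → Adj y x
    irrefl : ∀ {x} → ¬ Adj x x

open SimpleGraph public

degree : ∀ {n} → SimpleGraph n → Fin n → ℕ
degree G x = length (filter (adj? G x) (allFin _))

occ : ∀ {n} → List (Fin n) → Fin n → ℕ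
occ w x = length (filter (_≟ x) w)

Pos : ∀ {A : Set} → List A → Set
Pos w = Fin (length w)

Separates : ∀ {n} → List (Fin n) → Fin n → Fin n → Set
Separates w x y = ∀ (i j : Pos w) → i < j → lookup w i ≡ x → lookup w j ≡ x →
  ∃[ l ] (i < l × l < j × lookup w l ≡ y)

Alternate : ∀ {n} → List (Fin n) → Fin n → Fin n → Set
Alternate w x y = Separates w x y × Separates w y x

Represents : ∀ {n} → List (Fin n) → SimpleGraph n → Set
Represents w G = ∀ x y → x ≢ y →
  (Alternate w x y → Adj G x y) × (Adj G x y → Alternate w x y)

Perm : ℕ → Set
Perm m = Σ (Fin m → Fin m) Injective'
  where
  Injective' : (Fin m → Fin m) → Set
  Injective' f = ∀ {a b} → f a ≡ f b → a ≡ b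

Contains : ∀ {n m} → List (Fin n) → (Fin m → Fin m) → Set
Contains {m = m} w τ = Σ (Fin m → Pos w) λ ι →
  (∀ a b → a < b → ι a < ι b) ×
  (∀ a b → (lookup w (ι a) < lookup w (ι b) → τ a < τ b) ×
           (τ a < τ b → lookup w (ι a) < lookup w (ι b)))

Avoids : ∀ {n m} → List (Fin n) → (Fin m → Fin m) → Set
Avoids w τ = ¬ Contains w τ

-- Suppose x occurred k + 2 times.  Since x alternates with its neighbour a, the
-- letter a occurs k + 1 times, at q₀ < ⋯ < q_k, and since a alternates with each
-- of its neighbours, every gap (qᵢ, qᵢ₊₁) contains all of them.  Sort a and k of
-- its neighbours as ℓ₀ < ⋯ < ℓ_k, say a = ℓ_c, and let τ(s) = c.  Taking a at q_s
-- and, for t ≠ s, the letter ℓ_{τ(t)} in the gap number punchOut s t, i.e. in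
-- (q_t, q_{t+1}) if t < s and in (q_{t-1}, q_t) if t > s, yields a subsequence of
-- w that is order-isomorphic to τ.
module Submission where

open import Defs hiding (sym)
open import Data.Nat using (ℕ; suc; _≤_)
open import Data.Fin using (Fin)
open import Data.List using (List)
open import Data.Product using (_×_; ∃-syntax; proj₁)

import Data.Nat as ℕ
open import Data.Nat using (zero; z≤n; s≤s)
import Data.Nat.Properties as ℕₚ
import Data.Fin as Fin
open import Data.Fin using (zero; suc; toℕ; _<_; _≟_; inject₁; punchIn; punchOut; cast)
import Data.Fin.Properties as Finₚ
open import Data.Vec.Functional using (insertAt)
open import Data.Vec.Functional.Properties using (insertAt-lookup; insertAt-punchIn)
open import Data.List using (_∷_; length; lookup; filter; allFin)
open import Data.List.Properties using (length-tabulate; lookup-tabulate)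
open import Data.Product using (Σ; _,_; proj₂)
open import Data.Sum using (inj₁; inj₂)
open import Function using (id; _∘_)
open import Function.Definitions using (Injective)
open import Relation.Binary.Core using (_Preserves_⟶_)
open import Relation.Binary.Definitions using (tri<; tri≈; tri>)
open import Relation.Binary.PropositionalEquality
  using (_≡_; _≢_; refl; sym; trans; cong; subst; subst₂; module ≡-Reasoning)
open import Relation.Nullary using (Dec; yes; no; contradiction)

private
  variable
    m N : ℕ

StrictlyIncreasing : (Fin m → Fin N) → Set
StrictlyIncreasing f = f Preserves _<_ ⟶ _<_

module _ {f : Fin m → Fin N} (f-inc : StrictlyIncreasing f) where

  strictlyIncreasing⇒monotone : f Preserves Fin._≤_ ⟶ Fin._≤_
  strictlyIncreasing⇒monotone {i} {j} i≤j with ℕₚ.m≤n⇒m<n∨m≡n i≤j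
  ... | inj₁ i<j = ℕₚ.<⇒≤ (f-inc i<j)
  ... | inj₂ i≡j rewrite Finₚ.toℕ-injective i≡j = ℕₚ.≤-refl

  strictlyIncreasing⇒reflects-< : ∀ {i j} → f i < f j → i < j
  strictlyIncreasing⇒reflects-< {i} {j} fi<fj with Finₚ.<-cmp i j
  ... | tri< i<j _ _ = i<j
  ... | tri≈ _ refl _ = contradiction fi<fj (ℕₚ.<-irrefl refl)
  ... | tri> _ _ j<i = contradiction fi<fj (ℕₚ.<-asym (f-inc j<i))

injective⇒surjective : {f : Fin m → Fin m} → Injective _≡_ _≡_ f → ∀ r → ∃[ s ] f s ≡ r
injective⇒surjective {suc m} {f} f-inj r with Finₚ.any? (λ s → f s ≟ r)
... | yes hit = hit
... | no ¬hit =
  let i , j , i<j , collision = Finₚ.pigeonhole (ℕₚ.n<1+n m) (λ s → punchOut (r≢f s))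
  in contradiction (f-inj (Finₚ.punchOut-injective (r≢f i) (r≢f j) collision)) (ℕₚ.<⇒≢ i<j ∘ cong toℕ)
  where
  r≢f : ∀ s → r ≢ f s
  r≢f s r≡fs = ¬hit (s , sym r≡fs)

record Occurrences {A : Set} (P : A → Set) (xs : List A) (m : ℕ) : Set where
  field
    position   : Fin m → Pos xs
    increasing : StrictlyIncreasing position
    satisfies  : ∀ i → P (lookup xs (position i))

module _ {A : Set} {P : A → Set} where

  open Occurrences

  skip : ∀ {y ys} → Occurrences P ys m → Occurrences P (y ∷ ys) m
  skip o = record
    { position = suc ∘ position o ; increasing = s≤s ∘ increasing o ; satisfies = satisfies o }

  take : ∀ {y ys} → P y → Occurrences P ys m → Occurrences P (y ∷ ys) (suc m)
  take {y = y} {ys} py o = record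
    { position = position′ ; increasing = increasing′ ; satisfies = satisfies′ }
    where
    position′ : Fin (suc _) → Pos (y ∷ ys)
    position′ zero    = zero
    position′ (suc i) = suc (position o i)

    increasing′ : StrictlyIncreasing position′
    increasing′ {zero}  {suc j} _         = s≤s z≤n
    increasing′ {suc i} {suc j} (s≤s i<j) = s≤s (increasing o i<j)

    satisfies′ : ∀ i → P (lookup (y ∷ ys) (position′ i))
    satisfies′ zero    = py
    satisfies′ (suc i) = satisfies o i

  occurrences : (P? : ∀ a → Dec (P a)) (xs : List A) → m ≤ length (filter P? xs) → Occurrences P xs m
  occurrences {zero}  P? xs       _        = record { position = λ () ; increasing = λ {} ; satisfies = λ () }
  occurrences {suc m} P? (y ∷ ys) m≤count with P? y
  ... | yes py = take py (occurrences P? ys (ℕₚ.≤-pred m≤count))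
  ... | no _   = skip (occurrences P? ys m≤count)

toℕ-lookup-allFin : ∀ n (j : Pos (allFin n)) → toℕ (lookup (allFin n) j) ≡ toℕ j
toℕ-lookup-allFin n j = begin
  toℕ (lookup (allFin n) j)
    ≡⟨ cong (toℕ ∘ lookup (allFin n)) (sym (Finₚ.cast-involutive (sym len) len j)) ⟩
  toℕ (lookup (allFin n) (cast (sym len) (cast len j)))
    ≡⟨ cong toℕ (lookup-tabulate id (cast len j)) ⟩
  toℕ (cast len j)
    ≡⟨ Finₚ.toℕ-cast len j ⟩
  toℕ j ∎
  where
  open ≡-Reasoning
  len : length (allFin n) ≡ n
  len = length-tabulate id

sortedSatisfying : ∀ {n} {P : Fin n → Set} (P? : ∀ v → Dec (P v)) →
  m ≤ length (filter P? (allFin n)) → Σ (Fin m → Fin n) λ f → StrictlyIncreasing f × (∀ i → P (f i))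
sortedSatisfying {n = n} P? m≤count = lookup (allFin n) ∘ position , increasing′ , satisfies
  where
  open Occurrences (occurrences P? (allFin n) m≤count)
  increasing′ : StrictlyIncreasing (lookup (allFin n) ∘ position)
  increasing′ {i} {j} i<j = subst₂ ℕ._<_
    (sym (toℕ-lookup-allFin n (position i))) (sym (toℕ-lookup-allFin n (position j))) (increasing i<j)

FitsAt : (Fin m → Fin N) → Fin (suc m) → Fin N → Set
FitsAt xs i v = (∀ j → inject₁ j < i → xs j < v) × (∀ j → i Fin.≤ inject₁ j → v < xs j)

insertAt-all : ∀ {A : Set} (P : A → Set) (xs : Fin m → A) (i : Fin (suc m)) {v : A} →
  P v → (∀ j → P (xs j)) → ∀ t → P (insertAt xs i v t)
insertAt-all         P xs zero    pv pxs zero    = pv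
insertAt-all         P xs zero    pv pxs (suc t) = pxs t
insertAt-all {suc m} P xs (suc i) pv pxs zero    = pxs zero
insertAt-all {suc m} P xs (suc i) pv pxs (suc t) = insertAt-all P (xs ∘ suc) i pv (pxs ∘ suc) t

insertAt-punchOut : ∀ {A : Set} (xs : Fin m → A) (i : Fin (suc m)) (v : A) {t} (i≢t : i ≢ t) →
  insertAt xs i v t ≡ xs (punchOut i≢t)
insertAt-punchOut xs i v {t} i≢t = begin
  insertAt xs i v t                           ≡⟨ cong (insertAt xs i v) (sym (Finₚ.punchIn-punchOut i≢t)) ⟩
  insertAt xs i v (punchIn i (punchOut i≢t))  ≡⟨ insertAt-punchIn xs i v (punchOut i≢t) ⟩
  xs (punchOut i≢t)                           ∎
  where open ≡-Reasoning

insertAt-strictlyIncreasing : (xs : Fin m → Fin N) (i : Fin (suc m)) {v : Fin N} →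
  StrictlyIncreasing xs → FitsAt xs i v → StrictlyIncreasing (insertAt xs i v)
insertAt-strictlyIncreasing xs zero inc (_ , above) {zero}  {suc u} _         = above u z≤n
insertAt-strictlyIncreasing xs zero inc _           {suc t} {suc u} (s≤s t<u) = inc t<u
insertAt-strictlyIncreasing {suc m} xs (suc i) inc (below , _) {zero} {suc u} _ =
  insertAt-all (xs zero <_) (xs ∘ suc) i (below zero (s≤s z≤n)) (λ _ → inc (s≤s z≤n)) u
insertAt-strictlyIncreasing {suc m} xs (suc i) inc (below , above) {suc t} {suc u} (s≤s t<u) =
  insertAt-strictlyIncreasing (xs ∘ suc) i (inc ∘ s≤s)
    ((λ j → below (suc j) ∘ s≤s) , (λ j → above (suc j) ∘ s≤s)) t<u

insertionPoint : (xs : Fin m → Fin N) → StrictlyIncreasing xs → (v : Fin N) →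
  (∀ j → xs j ≢ v) → ∃[ i ] FitsAt xs i v
insertionPoint {zero}  xs inc v xs≢v = zero , (λ ()) , (λ ())
insertionPoint {suc m} xs inc v xs≢v with Finₚ.<-cmp (xs zero) v
... | tri≈ _ x₀≡v _ = contradiction x₀≡v (xs≢v zero)
... | tri> _ _ v<x₀ = zero , (λ _ ()) , λ j _ → ℕₚ.<-≤-trans v<x₀ (strictlyIncreasing⇒monotone inc z≤n)
... | tri< x₀<v _ _ with insertionPoint (xs ∘ suc) (inc ∘ s≤s) v (xs≢v ∘ suc)
...   | i , below , above = suc i , below′ , above′
  where
  below′ : ∀ j → inject₁ j < suc i → xs j < v
  below′ zero    _         = x₀<v
  below′ (suc j) (s≤s j<i) = below j j<i
  above′ : ∀ j → suc i Fin.≤ inject₁ j → v < xs j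
  above′ (suc j) (s≤s i≤j) = above j i≤j

<⇒suc≤inject₁ : {g h : Fin m} → g < h → suc g Fin.≤ inject₁ h
<⇒suc≤inject₁ {h = h} g<h = subst (ℕ._<_ _) (sym (Finₚ.toℕ-inject₁ h)) g<h

inject₁<⇒suc≤ : {g : Fin m} {s : Fin N} → inject₁ g < s → suc g Fin.≤ s
inject₁<⇒suc≤ {g = g} g<s = subst (ℕ._< _) (Finₚ.toℕ-inject₁ g) g<s

Interleaved : (Fin (suc m) → Fin N) → (Fin m → Fin N) → Set
Interleaved p q = ∀ g → p (inject₁ g) < q g × q g < p (suc g)

module _ {p : Fin (suc m) → Fin N} {q : Fin m → Fin N}
         (p-inc : StrictlyIncreasing p) (p<q<p : Interleaved p q) where

  open ℕₚ.≤-Reasoning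

  interleaved⇒strictlyIncreasing : StrictlyIncreasing q
  interleaved⇒strictlyIncreasing {g} {h} g<h = begin-strict
    toℕ (q g)            <⟨ proj₂ (p<q<p g) ⟩
    toℕ (p (suc g))      ≤⟨ strictlyIncreasing⇒monotone p-inc (<⇒suc≤inject₁ g<h) ⟩
    toℕ (p (inject₁ h))  <⟨ proj₁ (p<q<p h) ⟩
    toℕ (q h)            ∎

  interleaved⇒fitsAt : ∀ s → FitsAt q s (p s)
  interleaved⇒fitsAt s = below , above
    where
    below : ∀ g → inject₁ g < s → q g < p s
    below g g<s = begin-strict
      toℕ (q g)        <⟨ proj₂ (p<q<p g) ⟩
      toℕ (p (suc g))  ≤⟨ strictlyIncreasing⇒monotone p-inc (inject₁<⇒suc≤ g<s) ⟩
      toℕ (p s)        ∎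
    above : ∀ g → s Fin.≤ inject₁ g → p s < q g
    above g s≤g = begin-strict
      toℕ (p s)            ≤⟨ strictlyIncreasing⇒monotone p-inc s≤g ⟩
      toℕ (p (inject₁ g))  <⟨ proj₁ (p<q<p g) ⟩
      toℕ (q g)            ∎

separates⇒interleaved : ∀ {n} {w : List (Fin n)} {x : Fin n} (ys : Fin m → Fin n) →
  (∀ g → Separates w x (ys g)) →
  (p : Fin (suc m) → Pos w) → StrictlyIncreasing p → (∀ i → lookup w (p i) ≡ x) →
  Σ (Fin m → Pos w) λ q → Interleaved p q × (∀ g → lookup w (q g) ≡ ys g)
separates⇒interleaved {w = w} ys x∣ys p p-inc p≡x =
  (λ g → proj₁ (between g)) ,
  (λ g → let (_ , after , before , _) = between g in after , before) ,
  (λ g → let (_ , _ , _ , letter) = between g in letter)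
  where
  between : ∀ g → ∃[ l ] (p (inject₁ g) < l × l < p (suc g) × lookup w l ≡ ys g)
  between g = x∣ys g _ _ (p-inc (Finₚ.≤̄⇒inject₁< Finₚ.≤-refl)) (p≡x _) (p≡x _)

separates⇒occurrences : ∀ {n} {w : List (Fin n)} {x y : Fin n} →
  Separates w x y → Occurrences (_≡ x) w (suc m) → Occurrences (_≡ y) w m
separates⇒occurrences {m} {w = w} x∣y xOcc
  with separates⇒interleaved {w = w} (λ (_ : Fin m) → _) (λ _ → x∣y)
         (Occurrences.position xOcc) (Occurrences.increasing xOcc) (Occurrences.satisfies xOcc)
... | q , p<q<p , q≡y = record
  { position   = q
  ; increasing = interleaved⇒strictlyIncreasing (Occurrences.increasing xOcc) p<q<p
  ; satisfies  = q≡y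
  }

relabelling⇒contains : ∀ {n} {w : List (Fin n)} {τ : Fin m → Fin m}
  (π : Fin m → Pos w) (ℓ : Fin m → Fin n) → StrictlyIncreasing π → StrictlyIncreasing ℓ →
  (∀ t → lookup w (π t) ≡ ℓ (τ t)) → Contains w τ
relabelling⇒contains π ℓ π-inc ℓ-inc letter = π , (λ _ _ → π-inc) , λ t u →
  (λ w<w → strictlyIncreasing⇒reflects-< ℓ-inc (subst₂ _<_ (letter t) (letter u) w<w)) ,
  (λ τ<τ → subst₂ _<_ (sym (letter t)) (sym (letter u)) (ℓ-inc τ<τ))

module _ {n} (G : SimpleGraph n) where

  adj⇒separates : ∀ {w a b} → Represents w G → Adj G a b → Separates w a b
  adj⇒separates {a = a} {b} rep a∼b = proj₁ (proj₂ (rep a b a≢b) a∼b)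
    where
    a≢b : a ≢ b
    a≢b refl = irrefl G a∼b

  record SortedClosedNeighbourhood (a : Fin n) (m : ℕ) : Set where
    field
      vertex        : Fin (suc m) → Fin n
      increasing    : StrictlyIncreasing vertex
      centre        : Fin (suc m)
      vertex-centre : vertex centre ≡ a
      adjacent      : ∀ {i} → centre ≢ i → Adj G a (vertex i)

  sortedClosedNeighbourhood : ∀ a → m ≤ degree G a → SortedClosedNeighbourhood a m
  sortedClosedNeighbourhood a m≤deg with sortedSatisfying (adj? G a) m≤deg
  ... | neighbour , neighbour-inc , a∼neighbour
    with insertionPoint neighbour neighbour-inc a (λ j eq → irrefl G (subst (Adj G a) eq (a∼neighbour j)))
  ...   | centre , fits = record
    { vertex        = insertAt neighbour centre a
    ; increasing    = insertAt-strictlyIncreasing neighbour centre neighbour-inc fits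
    ; centre        = centre
    ; vertex-centre = insertAt-lookup neighbour centre a
    ; adjacent      = λ c≢i → subst (Adj G a) (sym (insertAt-punchOut neighbour centre a c≢i)) (a∼neighbour _)
    }

  closedNeighbourhood⇒contains : ∀ {k w a} (τ : Perm (suc k)) → Represents w G →
    SortedClosedNeighbourhood a k → Occurrences (_≡ a) w (suc k) → Contains w (proj₁ τ)
  closedNeighbourhood⇒contains {k} {w} {a} (τ , τ-inj) rep N aOcc =
    relabelling⇒contains {w = w} π vertex π-inc increasing letter
    where
    open SortedClosedNeighbourhood N
    open Occurrences aOcc renaming (position to q; increasing to q-inc; satisfies to q≡a)

    s : Fin (suc k)
    s = proj₁ (injective⇒surjective τ-inj centre)

    τs≡centre : τ s ≡ centre
    τs≡centre = proj₂ (injective⇒surjective τ-inj centre)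

    gapLetter : Fin k → Fin n
    gapLetter g = vertex (τ (punchIn s g))

    a∼gapLetter : ∀ g → Adj G a (gapLetter g)
    a∼gapLetter g = adjacent λ centre≡τ → Finₚ.punchInᵢ≢i s g (τ-inj (trans (sym centre≡τ) (sym τs≡centre)))

    gaps : Σ (Fin k → Pos w) λ gap → Interleaved q gap × (∀ g → lookup w (gap g) ≡ gapLetter g)
    gaps = separates⇒interleaved {w = w} gapLetter (adj⇒separates {w = w} rep ∘ a∼gapLetter) q q-inc q≡a

    gap : Fin k → Pos w
    gap = proj₁ gaps

    q<gap<q : Interleaved q gap
    q<gap<q = proj₁ (proj₂ gaps)

    gap≡letter : ∀ g → lookup w (gap g) ≡ gapLetter g
    gap≡letter = proj₂ (proj₂ gaps)

    π : Fin (suc k) → Pos w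
    π = insertAt gap s (q s)

    π-inc : StrictlyIncreasing π
    π-inc = insertAt-strictlyIncreasing gap s
      (interleaved⇒strictlyIncreasing {q = gap} q-inc q<gap<q) (interleaved⇒fitsAt {q = gap} q-inc q<gap<q s)

    letter : ∀ t → lookup w (π t) ≡ vertex (τ t)
    letter t with s ≟ t
    ... | yes refl = begin
      lookup w (π s)  ≡⟨ cong (lookup w) (insertAt-lookup gap s (q s)) ⟩
      lookup w (q s)  ≡⟨ q≡a s ⟩
      a               ≡⟨ sym vertex-centre ⟩
      vertex centre   ≡⟨ cong vertex (sym τs≡centre) ⟩
      vertex (τ s)    ∎
      where open ≡-Reasoning
    ... | no s≢t = begin
      lookup w (π t)                         ≡⟨ cong (lookup w) (insertAt-punchOut gap s (q s) s≢t) ⟩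
      lookup w (gap (punchOut s≢t))          ≡⟨ gap≡letter (punchOut s≢t) ⟩
      vertex (τ (punchIn s (punchOut s≢t)))  ≡⟨ cong (vertex ∘ τ) (Finₚ.punchIn-punchOut s≢t) ⟩
      vertex (τ t)                           ∎
      where open ≡-Reasoning

corollary3p2 : ∀ (k n : ℕ) → 1 ≤ k → (τ : Perm (suc k)) →
    (G : SimpleGraph n) → (w : List (Fin n)) →
    Avoids w (proj₁ τ) → Represents w G → (x : Fin n) →
    ∃[ a ] (Adj G x a × k ≤ degree G a) →
    occ w x ≤ suc k
corollary3p2 k n _ τ G w avoids rep x (a , x∼a , k≤deg) with occ w x ℕ.≤? suc k
... | yes few = few
... | no ¬few = contradiction contains avoids
  where
  xOcc : Occurrences (_≡ x) w (suc (suc k))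
  xOcc = occurrences (_≟ x) w (ℕₚ.≰⇒> ¬few)

  aOcc : Occurrences (_≡ a) w (suc k)
  aOcc = separates⇒occurrences (adj⇒separates G {w = w} rep x∼a) xOcc

  contains : Contains w (proj₁ τ)
  contains = closedNeighbourhood⇒contains G τ rep (sortedClosedNeighbourhood G a k≤deg) aOcc
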